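{- Let $(\mathbb{K},\succ)$ be a real-closed ordered field and let $(V,b)$ be a finite graph over $\mathbb{K}$ without isolated vertices and with at least one edge. Then its dual Cheeger constant satisfies $\overline h\succ \frac12$.
   Context: A graph over $\mathbb{K}$ is a pair $(V,b)$ with $V$ a set and $b:V\times V\to \mathbb{K}^+\cup\{0\}$ (nonnegative elements of $\mathbb{K}$) satisfying $b(x,y)=b(y,x)$ and $b(x,x)=0$; we write $x\sim y$ iff $b(x,y)\neq 0$ (an edge). Set $b(x)=\sum_{y\in V}b(x,y)$; $x$ is isolated if $b(x)=0$. For $V_1\subset V$, $b(V_1)=\sum_{x\in V_1}b(x)$, and for disjoint $V_1,V_2\subset V$, $b(V_1,V_2)=\sum_{x\in V_1,y\in V_2}b(x,y)$. The dual Cheeger constant is $\overline h=\max \frac{2b(V_1,V_2)}{b(V_1)+b(V_2)}$, the maximum over all pairs of nonempty disjoint subsets $V_1,V_2\subset V$. The symbol $\succ$ denotes the order of $\mathbb{K}$. -}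

module Defs where

open import Level using (Level; suc; _⊔_)
open import Data.Nat using (ℕ; zero) renaming (suc to sucℕ)
open import Data.Bool using (Bool; true; false; if_then_else_)
open import Data.Fin using (Fin) renaming (zero to fz; suc to fs)
open import Data.Fin.Subset using (Subset; Nonempty; Empty; _∩_)
open import Data.Vec using (lookup)
open import Data.List using (List; []; _∷_; length)
open import Data.Product using (Σ; ∃; _×_; _,_)
open import Data.Sum using (_⊎_)
open import Relation.Binary.PropositionalEquality using (_≡_; _≢_)
open import Relation.Nullary using (¬_)

-- Inverse is a total operation; only x * x⁻¹ ≡ 1 for x ≢ 0 is required
-- (the value of 0⁻¹ is irrelevant and never used meaningfully).

record OrderedField (ℓ : Level) : Set (suc ℓ) where
  infixl 6 _+_
  infixl 7 _*_
  infix 4 _≺_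
  field
    K    : Set ℓ
    𝟘 𝟙  : K
    _+_ _*_ : K → K → K
    -_   : K → K
    _⁻¹  : K → K
    _≺_  : K → K → Set ℓ      -- strict order; x ≻ y means y ≺ x
    +-assoc  : ∀ x y z → (x + y) + z ≡ x + (y + z)
    +-comm   : ∀ x y → x + y ≡ y + x
    +-idˡ    : ∀ x → 𝟘 + x ≡ x
    -‿invˡ   : ∀ x → (- x) + x ≡ 𝟘
    *-assoc  : ∀ x y z → (x * y) * z ≡ x * (y * z)
    *-comm   : ∀ x y → x * y ≡ y * x
    *-idˡ    : ∀ x → 𝟙 * x ≡ x
    distribˡ : ∀ x y z → x * (y + z) ≡ (x * y) + (x * z)
    𝟘≢𝟙      : 𝟘 ≢ 𝟙
    ⁻¹-invʳ  : ∀ x → x ≢ 𝟘 → x * (x ⁻¹) ≡ 𝟙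
    ≺-irrefl : ∀ x → ¬ (x ≺ x)
    ≺-trans  : ∀ {x y z} → x ≺ y → y ≺ z → x ≺ z
    ≺-trich  : ∀ x y → x ≺ y ⊎ (x ≡ y ⊎ y ≺ x)
    +-mono-≺ : ∀ {x y} z → x ≺ y → x + z ≺ y + z
    *-pos    : ∀ {x y} → 𝟘 ≺ x → 𝟘 ≺ y → 𝟘 ≺ x * y

  _≼_ : K → K → Set ℓ
  x ≼ y = x ≺ y ⊎ x ≡ y

  _/_ : K → K → K
  x / y = x * (y ⁻¹)

  𝟚 : K
  𝟚 = 𝟙 + 𝟙

  -- Polynomials as coefficient lists [a₀, a₁, …, aₙ] (lowest degree first).
  eval : List K → K → K
  eval [] x = 𝟘
  eval (a ∷ as) x = a + x * eval as x

  lastCoeffNonzero : List K → Set ℓ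
  lastCoeffNonzero [] = 𝟘 ≡ 𝟙  -- impossible: the zero list has no leading coefficient
  lastCoeffNonzero (a ∷ []) = a ≢ 𝟘
  lastCoeffNonzero (a ∷ b ∷ as) = lastCoeffNonzero (b ∷ as)

  -- degree of a coefficient list with nonzero last entry = length - 1
  data OddLength : ℕ → Set where
    two  : OddLength 2
    plus2 : ∀ {n} → OddLength n → OddLength (sucℕ (sucℕ n))

record IsRealClosed {ℓ} (F : OrderedField ℓ) : Set ℓ where
  open OrderedField F
  field
    sqrt-exists : ∀ x → 𝟘 ≼ x → ∃ λ y → y * y ≡ x
    odd-root    : ∀ (p : List K) → lastCoeffNonzero p → OddLength (length p)
                  → ∃ λ x → eval p x ≡ 𝟘

module _ {ℓ} (F : OrderedField ℓ) where
  open OrderedField F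

  ΣFin : ∀ {n} → (Fin n → K) → K
  ΣFin {zero} f = 𝟘
  ΣFin {sucℕ n} f = f fz + ΣFin (λ i → f (fs i))

  record Graph (n : ℕ) : Set ℓ where
    field
      b       : Fin n → Fin n → K
      b-nonneg : ∀ x y → 𝟘 ≼ b x y
      b-sym    : ∀ x y → b x y ≡ b y x
      b-diag   : ∀ x → b x x ≡ 𝟘

  module _ {n : ℕ} (G : Graph n) where
    open Graph G

    deg : Fin n → K
    deg x = ΣFin (λ y → b x y)

    Isolated : Fin n → Set ℓ
    Isolated x = deg x ≡ 𝟘

    HasEdge : Set ℓ
    HasEdge = ∃ λ x → ∃ λ y → b x y ≢ 𝟘

    bSet : Subset n → K
    bSet V₁ = ΣFin (λ x → if lookup V₁ x then deg x else 𝟘)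

    bPair : Subset n → Subset n → K
    bPair V₁ V₂ = ΣFin (λ x → ΣFin (λ y →
      if lookup V₁ x then (if lookup V₂ y then b x y else 𝟘) else 𝟘))

    Admissible : Subset n → Subset n → Set
    Admissible V₁ V₂ = Nonempty V₁ × Nonempty V₂ × Empty (V₁ ∩ V₂)

    ratio : Subset n → Subset n → K
    ratio V₁ V₂ = (𝟚 * bPair V₁ V₂) / (bSet V₁ + bSet V₂)

    IsDualCheeger : K → Set ℓ
    IsDualCheeger h =
      (∃ λ V₁ → ∃ λ V₂ → Admissible V₁ V₂ × ratio V₁ V₂ ≡ h)
      × (∀ V₁ V₂ → Admissible V₁ V₂ → ratio V₁ V₂ ≼ h)

{-# OPTIONS --safe #-}
-- Colour the vertices one at a time, each on the side where it has less weight
-- to the vertices already coloured; then the cut edges weigh at least as much as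
-- the inner ones.  Strictness comes from the first vertex with an edge to the
-- earlier ones: while no edge has been seen, the newest vertex is put alone
-- against all earlier ones.  For such a partition V₁ ⊔ V₂,
-- b(V₁) + b(V₂) = inner + cut < 2 cut = 4 b(V₁,V₂), so its ratio exceeds 1/2.
module Submission where

open import Defs
open import Level using (Level)
open import Data.Nat using (ℕ; zero; suc)
open import Data.Bool using (Bool; true; false; not; _xor_; if_then_else_)
open import Data.Bool.Properties using (xor-comm; not-distribˡ-xor; not-involutive; xor-annihilates-not)
open import Data.Fin using (Fin) renaming (zero to fz; suc to fs)
open import Data.Fin.Subset using (Subset; outside; inside; ⊤; ⊥; ∁; _∈_; Nonempty)
open import Data.Fin.Subset.Properties using (nonempty?; Empty-unique; ∉⊥; ∩-inverseʳ)
open import Data.Vec using (_∷_; lookup)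
open import Data.Vec.Properties using (lookup-map; lookup-replicate)
open import Data.Product using (∃; _,_)
open import Data.Sum using (_⊎_; inj₁; inj₂)
open import Data.Empty using (⊥-elim)
open import Function using (_∘_)
open import Relation.Nullary using (¬_; yes; no; contradiction)
open import Relation.Binary.Bundles using (StrictPartialOrder)
open import Relation.Binary.PropositionalEquality
open import Algebra.Bundles using (CommutativeRing)
open import Algebra.Consequences.Propositional using (comm∧idˡ⇒id; comm∧invˡ⇒inv; comm∧distrˡ⇒distrʳ)
open import Relation.Binary.PropositionalEquality.Algebra using (isMagma)
import Algebra.Properties.CommutativeSemigroup as CommutativeSemigroupProperties
import Algebra.Properties.CommutativeMonoid.Sum as SumProperties
import Algebra.Properties.Group as GroupProperties
import Algebra.Properties.Ring as RingProperties
import Relation.Binary.Reasoning.StrictPartialOrder as StrictReasoning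

module OrderedFieldProperties {ℓ} (F : OrderedField ℓ) where
  open OrderedField F

  commutativeRing : CommutativeRing ℓ ℓ
  commutativeRing = record
    { Carrier = K ; _≈_ = _≡_ ; _+_ = _+_ ; _*_ = _*_ ; -_ = -_ ; 0# = 𝟘 ; 1# = 𝟙
    ; isCommutativeRing = record
      { isRing = record
        { +-isAbelianGroup = record
          { isGroup = record
            { isMonoid = record
              { isSemigroup = record { isMagma = isMagma _+_ ; assoc = +-assoc }
              ; identity = comm∧idˡ⇒id +-comm +-idˡ }
            ; inverse = comm∧invˡ⇒inv +-comm -‿invˡ
            ; ⁻¹-cong = cong -_ }
          ; comm = +-comm }
        ; *-cong = cong₂ _*_
        ; *-assoc = *-assoc
        ; *-identity = comm∧idˡ⇒id *-comm *-idˡ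
        ; distrib = distribˡ , comm∧distrˡ⇒distrʳ *-comm distribˡ }
      ; *-comm = *-comm } }

  open CommutativeRing commutativeRing public
    using (_-_; +-identityʳ; -‿inverseʳ; *-identityʳ; distribʳ; +-group; *-commutativeSemigroup)
  open RingProperties (CommutativeRing.ring commutativeRing) using (-1*x≈-x)
  open GroupProperties +-group using (//-rightDividesˡ; ⁻¹-involutive)
  open CommutativeSemigroupProperties *-commutativeSemigroup using (x∙yz≈y∙xz; xy∙z≈y∙xz)

  strictPartialOrder : StrictPartialOrder ℓ ℓ ℓ
  strictPartialOrder = record
    { Carrier = K ; _≈_ = _≡_ ; _<_ = _≺_
    ; isStrictPartialOrder = record
      { isEquivalence = isEquivalence
      ; irrefl = λ { refl → ≺-irrefl _ }
      ; trans = ≺-trans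
      ; <-resp-≈ = resp₂ _≺_ } }

  open StrictReasoning strictPartialOrder

  𝟘≺x⇒x≢𝟘 : ∀ {x} → 𝟘 ≺ x → x ≢ 𝟘
  𝟘≺x⇒x≢𝟘 𝟘≺x refl = ≺-irrefl 𝟘 𝟘≺x

  𝟘≼x∧x≢𝟘⇒𝟘≺x : ∀ {x} → 𝟘 ≼ x → x ≢ 𝟘 → 𝟘 ≺ x
  𝟘≼x∧x≢𝟘⇒𝟘≺x (inj₁ 𝟘≺x) _   = 𝟘≺x
  𝟘≼x∧x≢𝟘⇒𝟘≺x (inj₂ 𝟘≡x) x≢𝟘 = contradiction (sym 𝟘≡x) x≢𝟘

  +-monoʳ-≺ : ∀ z {x y} → x ≺ y → z + x ≺ z + y
  +-monoʳ-≺ z {x} {y} x≺y = begin-strict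
    z + x  ≡⟨ +-comm z x ⟩
    x + z  <⟨ +-mono-≺ z x≺y ⟩
    y + z  ≡⟨ +-comm y z ⟩
    z + y  ∎

  +-monoˡ-≼ : ∀ z {x y} → x ≼ y → (x + z) ≼ (y + z)
  +-monoˡ-≼ z (inj₁ x≺y) = inj₁ (+-mono-≺ z x≺y)
  +-monoˡ-≼ z (inj₂ refl) = inj₂ refl

  +-monoʳ-≼ : ∀ z {x y} → x ≼ y → (z + x) ≼ (z + y)
  +-monoʳ-≼ z (inj₁ x≺y) = inj₁ (+-monoʳ-≺ z x≺y)
  +-monoʳ-≼ z (inj₂ refl) = inj₂ refl

  +-mono-≼ : ∀ {a b c d} → a ≼ b → c ≼ d → (a + c) ≼ (b + d)
  +-mono-≼ {a} {b} {c} {d} a≼b c≼d = begin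
    a + c  ≤⟨ +-monoˡ-≼ c a≼b ⟩
    b + c  ≤⟨ +-monoʳ-≼ b c≼d ⟩
    b + d  ∎

  +-mono-≼-≺ : ∀ {a b c d} → a ≼ b → c ≺ d → a + c ≺ b + d
  +-mono-≼-≺ {a} {b} {c} {d} a≼b c≺d = begin-strict
    a + c  ≤⟨ +-monoˡ-≼ c a≼b ⟩
    b + c  <⟨ +-monoʳ-≺ b c≺d ⟩
    b + d  ∎

  +-mono-≺-≼ : ∀ {a b c d} → a ≺ b → c ≼ d → a + c ≺ b + d
  +-mono-≺-≼ {a} {b} {c} {d} a≺b c≼d = begin-strict
    a + c  <⟨ +-mono-≺ c a≺b ⟩
    b + c  ≤⟨ +-monoʳ-≼ b c≼d ⟩
    b + d  ∎

  x≺y⇒𝟘≺y-x : ∀ {x y} → x ≺ y → 𝟘 ≺ y - x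
  x≺y⇒𝟘≺y-x {x} {y} x≺y = begin-strict
    𝟘      ≡⟨ -‿inverseʳ x ⟨
    x - x  <⟨ +-mono-≺ (- x) x≺y ⟩
    y - x  ∎

  *-monoˡ-≺ : ∀ {k x y} → 𝟘 ≺ k → x ≺ y → k * x ≺ k * y
  *-monoˡ-≺ {k} {x} {y} 𝟘≺k x≺y = begin-strict
    k * x                ≡⟨ +-idˡ (k * x) ⟨
    𝟘 + k * x            <⟨ +-mono-≺ (k * x) (*-pos 𝟘≺k (x≺y⇒𝟘≺y-x x≺y)) ⟩
    k * (y - x) + k * x  ≡⟨ distribˡ k (y - x) x ⟨
    k * ((y - x) + x)    ≡⟨ cong (k *_) (//-rightDividesˡ x y) ⟩
    k * y                ∎

  *-cancelˡ-≺ : ∀ {k x y} → 𝟘 ≺ k → k * x ≺ k * y → x ≺ y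
  *-cancelˡ-≺ {k} {x} {y} 𝟘≺k kx≺ky with ≺-trich x y
  ... | inj₁ x≺y        = x≺y
  ... | inj₂ (inj₁ refl) = ⊥-elim (≺-irrefl (k * x) kx≺ky)
  ... | inj₂ (inj₂ y≺x) = ⊥-elim (≺-irrefl (k * x) (≺-trans kx≺ky (*-monoˡ-≺ 𝟘≺k y≺x)))

  𝟘≺𝟙 : 𝟘 ≺ 𝟙
  𝟘≺𝟙 with ≺-trich 𝟘 𝟙
  ... | inj₁ 𝟘≺𝟙        = 𝟘≺𝟙
  ... | inj₂ (inj₁ 𝟘≡𝟙) = contradiction 𝟘≡𝟙 𝟘≢𝟙
  ... | inj₂ (inj₂ 𝟙≺𝟘) = ⊥-elim (≺-irrefl 𝟘 (begin-strict
    𝟘              <⟨ *-pos 𝟘≺-𝟙 𝟘≺-𝟙 ⟩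
    (- 𝟙) * (- 𝟙)  ≡⟨ -1*x≈-x (- 𝟙) ⟩
    - (- 𝟙)        ≡⟨ ⁻¹-involutive 𝟙 ⟩
    𝟙              <⟨ 𝟙≺𝟘 ⟩
    𝟘              ∎))
    where
    𝟘≺-𝟙 : 𝟘 ≺ - 𝟙
    𝟘≺-𝟙 = subst (𝟘 ≺_) (+-idˡ (- 𝟙)) (x≺y⇒𝟘≺y-x 𝟙≺𝟘)

  𝟚*x≡x+x : ∀ x → 𝟚 * x ≡ x + x
  𝟚*x≡x+x x = trans (distribʳ x 𝟙 𝟙) (cong₂ _+_ (*-idˡ x) (*-idˡ x))

  𝟘≺𝟚 : 𝟘 ≺ 𝟚
  𝟘≺𝟚 = begin-strict
    𝟘       ≡⟨ +-idˡ 𝟘 ⟨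
    𝟘 + 𝟘   <⟨ +-mono-≼-≺ (inj₁ 𝟘≺𝟙) 𝟘≺𝟙 ⟩
    𝟙 + 𝟙   ∎

  half≺quotient : ∀ {c d} → 𝟘 ≺ d → d ≺ c + c → 𝟙 / 𝟚 ≺ c / d
  half≺quotient {c} {d} 𝟘≺d d≺c+c = *-cancelˡ-≺ (*-pos 𝟘≺𝟚 𝟘≺d) (begin-strict
    (𝟚 * d) * (𝟙 / 𝟚)     ≡⟨ cong ((𝟚 * d) *_) (*-idˡ (𝟚 ⁻¹)) ⟩
    (𝟚 * d) * 𝟚 ⁻¹        ≡⟨ xy∙z≈y∙xz 𝟚 d (𝟚 ⁻¹) ⟩
    d * (𝟚 * 𝟚 ⁻¹)        ≡⟨ cong (d *_) (⁻¹-invʳ 𝟚 (𝟘≺x⇒x≢𝟘 𝟘≺𝟚)) ⟩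
    d * 𝟙                 ≡⟨ *-identityʳ d ⟩
    d                     <⟨ d≺c+c ⟩
    c + c                 ≡⟨ 𝟚*x≡x+x c ⟨
    𝟚 * c                 ≡⟨ cong (𝟚 *_) (*-identityʳ c) ⟨
    𝟚 * (c * 𝟙)           ≡⟨ cong (λ t → 𝟚 * (c * t)) (⁻¹-invʳ d (𝟘≺x⇒x≢𝟘 𝟘≺d)) ⟨
    𝟚 * (c * (d * d ⁻¹))  ≡⟨ cong (𝟚 *_) (x∙yz≈y∙xz d c (d ⁻¹)) ⟨
    𝟚 * (d * (c / d))     ≡⟨ *-assoc 𝟚 d (c / d) ⟨
    (𝟚 * d) * (c / d)     ∎)

module FiniteSumProperties {ℓ} (F : OrderedField ℓ) where
  open OrderedField F
  open OrderedFieldProperties F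
  open SumProperties (CommutativeRing.+-commutativeMonoid commutativeRing)
    using (sum; ∑-distrib-+; ∑-comm; sum-replicate-zero)

  ΣFin≡sum : ∀ {n} (f : Fin n → K) → ΣFin F f ≡ sum f
  ΣFin≡sum {zero} f = refl
  ΣFin≡sum {suc n} f = cong (f fz +_) (ΣFin≡sum (f ∘ fs))

  ΣFin-cong : ∀ {n} {f g : Fin n → K} → (∀ i → f i ≡ g i) → ΣFin F f ≡ ΣFin F g
  ΣFin-cong {zero} f≗g = refl
  ΣFin-cong {suc n} f≗g = cong₂ _+_ (f≗g fz) (ΣFin-cong (f≗g ∘ fs))

  ΣFin-zero : ∀ {n} {f : Fin n → K} → (∀ i → f i ≡ 𝟘) → ΣFin F f ≡ 𝟘
  ΣFin-zero {n} f≗𝟘 = trans (ΣFin-cong f≗𝟘) (trans (ΣFin≡sum {n} (λ _ → 𝟘)) (sum-replicate-zero n))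

  ΣFin-distrib-+ : ∀ {n} (f g : Fin n → K) →
                   ΣFin F (λ i → f i + g i) ≡ ΣFin F f + ΣFin F g
  ΣFin-distrib-+ f g = begin
    ΣFin F (λ i → f i + g i)  ≡⟨ ΣFin≡sum (λ i → f i + g i) ⟩
    sum (λ i → f i + g i)     ≡⟨ ∑-distrib-+ f g ⟩
    sum f + sum g             ≡⟨ cong₂ _+_ (ΣFin≡sum f) (ΣFin≡sum g) ⟨
    ΣFin F f + ΣFin F g       ∎
    where open ≡-Reasoning

  ΣFin-comm : ∀ {m n} (f : Fin m → Fin n → K) →
              ΣFin F (λ i → ΣFin F (f i)) ≡ ΣFin F (λ j → ΣFin F (λ i → f i j))
  ΣFin-comm f = begin
    ΣFin F (λ i → ΣFin F (f i))               ≡⟨ ΣFin-cong (λ i → ΣFin≡sum (f i)) ⟩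
    ΣFin F (λ i → sum (f i))                  ≡⟨ ΣFin≡sum (λ i → sum (f i)) ⟩
    sum (λ i → sum (f i))                     ≡⟨ ∑-comm f ⟩
    sum (λ j → sum (λ i → f i j))             ≡⟨ ΣFin≡sum (λ j → sum (λ i → f i j)) ⟨
    ΣFin F (λ j → sum (λ i → f i j))          ≡⟨ ΣFin-cong (λ j → ΣFin≡sum (λ i → f i j)) ⟨
    ΣFin F (λ j → ΣFin F (λ i → f i j))       ∎
    where open ≡-Reasoning

  ΣFin²-cong : ∀ {m n} {f g : Fin m → Fin n → K} → (∀ i j → f i j ≡ g i j) →
               ΣFin F (λ i → ΣFin F (f i)) ≡ ΣFin F (λ i → ΣFin F (g i))
  ΣFin²-cong f≗g = ΣFin-cong (λ i → ΣFin-cong (f≗g i))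

  ΣFin²-distrib-+ : ∀ {m n} (f g : Fin m → Fin n → K) →
                    ΣFin F (λ i → ΣFin F (λ j → f i j + g i j))
                      ≡ ΣFin F (λ i → ΣFin F (f i)) + ΣFin F (λ i → ΣFin F (g i))
  ΣFin²-distrib-+ f g = trans (ΣFin-cong (λ i → ΣFin-distrib-+ (f i) (g i)))
                              (ΣFin-distrib-+ (λ i → ΣFin F (f i)) (λ i → ΣFin F (g i)))

  ΣFin-mono-≼ : ∀ {n} {f g : Fin n → K} → (∀ i → f i ≼ g i) → ΣFin F f ≼ ΣFin F g
  ΣFin-mono-≼ {zero} f≼g = inj₂ refl
  ΣFin-mono-≼ {suc n} f≼g = +-mono-≼ (f≼g fz) (ΣFin-mono-≼ (f≼g ∘ fs))

  ΣFin-nonneg : ∀ {n} {f : Fin n → K} → (∀ i → 𝟘 ≼ f i) → 𝟘 ≼ ΣFin F f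
  ΣFin-nonneg {n} {f} 𝟘≼f = subst (_≼ ΣFin F f) (ΣFin-zero {n} (λ _ → refl)) (ΣFin-mono-≼ 𝟘≼f)

  ΣFin-pos : ∀ {n} {f : Fin n → K} → (∀ i → 𝟘 ≼ f i) → ∀ j → 𝟘 ≺ f j → 𝟘 ≺ ΣFin F f
  ΣFin-pos {f = f} 𝟘≼f fz 𝟘≺fj =
    subst (_≺ ΣFin F f) (+-idˡ 𝟘) (+-mono-≺-≼ 𝟘≺fj (ΣFin-nonneg (𝟘≼f ∘ fs)))
  ΣFin-pos {f = f} 𝟘≼f (fs j) 𝟘≺fj =
    subst (_≺ ΣFin F f) (+-idˡ 𝟘) (+-mono-≼-≺ (𝟘≼f fz) (ΣFin-pos (𝟘≼f ∘ fs) j 𝟘≺fj))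

module WeightedGraphProperties {ℓ} (F : OrderedField ℓ) where
  open OrderedField F
  open OrderedFieldProperties F
  open FiniteSumProperties F
  open StrictReasoning strictPartialOrder
  open Graph

  volume : ∀ {n} → Graph F n → K
  volume G = ΣFin F (deg F G)

  deg-nonneg : ∀ {n} (G : Graph F n) x → 𝟘 ≼ deg F G x
  deg-nonneg G x = ΣFin-nonneg (b-nonneg G x)

  volume-nonneg : ∀ {n} (G : Graph F n) → 𝟘 ≼ volume G
  volume-nonneg G = ΣFin-nonneg (deg-nonneg G)

  volume-pos : ∀ {n} (G : Graph F n) → HasEdge F G → 𝟘 ≺ volume G
  volume-pos G (x , y , bxy≢𝟘) =
    ΣFin-pos (deg-nonneg G) x (ΣFin-pos (b-nonneg G x) y (𝟘≼x∧x≢𝟘⇒𝟘≺x (b-nonneg G x y) bxy≢𝟘))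

  tailGraph : ∀ {n} → Graph F (suc n) → Graph F n
  tailGraph G = record
    { b        = λ x y → b G (fs x) (fs y)
    ; b-nonneg = λ x y → b-nonneg G (fs x) (fs y)
    ; b-sym    = λ x y → b-sym G (fs x) (fs y)
    ; b-diag   = λ x → b-diag G (fs x)
    }

  volume-tailGraph : ∀ {n} (G : Graph F (suc n)) →
                     volume G ≡ deg F G fz + (deg F G fz + volume (tailGraph G))
  volume-tailGraph G = cong (deg F G fz +_) (begin-equality
    ΣFin F (λ x → b G (fs x) fz + deg F (tailGraph G) x)  ≡⟨ ΣFin-distrib-+ _ (deg F (tailGraph G)) ⟩
    ΣFin F (λ x → b G (fs x) fz) + volume (tailGraph G)   ≡⟨ cong (_+ volume (tailGraph G)) first-column ⟩
    deg F G fz + volume (tailGraph G)                     ∎)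
    where
    first-column : ΣFin F (λ x → b G (fs x) fz) ≡ deg F G fz
    first-column = begin-equality
      ΣFin F (λ x → b G (fs x) fz)             ≡⟨ ΣFin-cong (λ x → b-sym G (fs x) fz) ⟩
      ΣFin F (λ y → b G fz (fs y))             ≡⟨ +-idˡ _ ⟨
      𝟘 + ΣFin F (λ y → b G fz (fs y))         ≡⟨ cong (_+ ΣFin F (λ y → b G fz (fs y))) (b-diag G fz) ⟨
      deg F G fz                               ∎

  keep : Bool → K → K
  keep c v = if c then v else 𝟘

  keep-nonneg : ∀ c {v} → 𝟘 ≼ v → 𝟘 ≼ keep c v
  keep-nonneg true  𝟘≼v = 𝟘≼v
  keep-nonneg false _   = inj₂ refl

  keep-≼ : ∀ c {v} → 𝟘 ≼ v → keep c v ≼ v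
  keep-≼ true  _   = inj₂ refl
  keep-≼ false 𝟘≼v = 𝟘≼v

  keep-zero : ∀ c {v} → v ≡ 𝟘 → keep c v ≡ 𝟘
  keep-zero true  v≡𝟘 = v≡𝟘
  keep-zero false _   = refl

  keep-+-keep-not : ∀ c c′ v → c′ ≡ not c → keep c v + keep c′ v ≡ v
  keep-+-keep-not true  _ v refl = +-identityʳ v
  keep-+-keep-not false _ v refl = +-idˡ v

  keepEdges : ∀ {n} (m : Fin n → Fin n → Bool) → (∀ x y → m x y ≡ m y x) → Graph F n → Graph F n
  keepEdges m m-sym G = record
    { b        = λ x y → keep (m x y) (b G x y)
    ; b-nonneg = λ x y → keep-nonneg (m x y) (b-nonneg G x y)
    ; b-sym    = λ x y → cong₂ keep (m-sym x y) (b-sym G x y)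
    ; b-diag   = λ x → keep-zero (m x x) (b-diag G x)
    }

  crossing : ∀ {n} → Subset n → Fin n → Fin n → Bool
  crossing p x y = lookup p x xor lookup p y

  crossing-sym : ∀ {n} (p : Subset n) x y → crossing p x y ≡ crossing p y x
  crossing-sym p x y = xor-comm (lookup p x) (lookup p y)

  innerGraph cutGraph : ∀ {n} → Subset n → Graph F n → Graph F n
  innerGraph p = keepEdges (λ x y → not (crossing p x y)) (λ x y → cong not (crossing-sym p x y))
  cutGraph p = keepEdges (crossing p) (crossing-sym p)

  volume-cut+inner : ∀ {n} (p : Subset n) (G : Graph F n) →
                     volume (cutGraph p G) + volume (innerGraph p G) ≡ volume G
  volume-cut+inner p G = trans (sym (ΣFin²-distrib-+ (b (cutGraph p G)) (b (innerGraph p G))))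
    (ΣFin²-cong (λ x y → keep-+-keep-not (crossing p x y) _ (b G x y) refl))

  volume-innerGraph-≼ : ∀ {n} (p : Subset n) (G : Graph F n) → volume (innerGraph p G) ≼ volume G
  volume-innerGraph-≼ p G =
    ΣFin-mono-≼ (λ x → ΣFin-mono-≼ (λ y → keep-≼ (not (crossing p x y)) (b-nonneg G x y)))

  DominatingCut : ∀ {n} → Graph F n → Subset n → Set ℓ
  DominatingCut G p = volume (innerGraph p G) ≺ volume (cutGraph p G)

  deg-inner≡deg-cut : ∀ {n} c (p : Subset n) (G : Graph F (suc n)) →
                      deg F (innerGraph (not c ∷ p) G) fz ≡ deg F (cutGraph (c ∷ p) G) fz
  deg-inner≡deg-cut c p G =
    cong₂ _+_ (trans (b-diag (innerGraph (not c ∷ p) G) fz) (sym (b-diag (cutGraph (c ∷ p) G) fz)))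
              (ΣFin-cong (λ y → cong (λ k → keep k (b G fz (fs y))) (not-not-xor (lookup p y))))
    where
    not-not-xor : ∀ v → not (not c xor v) ≡ c xor v
    not-not-xor v = trans (not-distribˡ-xor (not c) v) (cong (_xor v) (not-involutive c))

  better-side : ∀ {n} (p : Subset n) (G : Graph F (suc n)) →
                ∃ λ c → deg F (innerGraph (c ∷ p) G) fz ≼ deg F (cutGraph (c ∷ p) G) fz
  better-side p G with ≺-trich (deg F (innerGraph (true ∷ p) G) fz) (deg F (cutGraph (true ∷ p) G) fz)
  ... | inj₁ inner≺cut        = true , inj₁ inner≺cut
  ... | inj₂ (inj₁ inner≡cut) = true , inj₂ inner≡cut
  ... | inj₂ (inj₂ cut≺inner) =
    false , inj₁ (subst₂ _≺_ (sym (deg-inner≡deg-cut true p G)) (deg-inner≡deg-cut false p G) cut≺inner)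

  extend-dominatingCut : ∀ {n} (G : Graph F (suc n)) {p} → DominatingCut (tailGraph G) p →
                         ∃ (DominatingCut G)
  extend-dominatingCut G {p} dominating with better-side p G
  ... | c , inner≼cut = c ∷ p , (begin-strict
    volume (innerGraph (c ∷ p) G)                     ≡⟨ volume-tailGraph (innerGraph (c ∷ p) G) ⟩
    dᵢ + (dᵢ + volume (innerGraph p (tailGraph G)))   <⟨ +-mono-≼-≺ inner≼cut (+-mono-≼-≺ inner≼cut dominating) ⟩
    d꜀ + (d꜀ + volume (cutGraph p (tailGraph G)))     ≡⟨ volume-tailGraph (cutGraph (c ∷ p) G) ⟨
    volume (cutGraph (c ∷ p) G)                       ∎)
    where
    dᵢ = deg F (innerGraph (c ∷ p) G) fz
    d꜀ = deg F (cutGraph (c ∷ p) G) fz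

  star : ∀ {n} → Subset (suc n)
  star = outside ∷ ⊤

  deg-inner-star : ∀ {n} (G : Graph F (suc n)) → deg F (innerGraph star G) fz ≡ 𝟘
  deg-inner-star G = trans
    (cong₂ _+_ (b-diag (innerGraph star G) fz)
               (ΣFin-zero (λ y → cong (λ k → keep (not k) (b G fz (fs y))) (lookup-replicate y inside))))
    (+-idˡ 𝟘)

  deg-cut-star : ∀ {n} (G : Graph F (suc n)) → deg F (cutGraph star G) fz ≡ deg F G fz
  deg-cut-star G =
    cong₂ _+_ (sym (b-diag G fz))
              (ΣFin-cong (λ y → cong (λ k → keep k (b G fz (fs y))) (lookup-replicate y inside)))

  star-dominatingCut : ∀ {n} (G : Graph F (suc n)) → volume (tailGraph G) ≡ 𝟘 →
                       𝟘 ≺ deg F G fz → DominatingCut G star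
  star-dominatingCut G tail≡𝟘 𝟘≺d = begin-strict
    volume (innerGraph star G)                ≡⟨ volume-tailGraph (innerGraph star G) ⟩
    dᵢ + (dᵢ + volume (innerGraph ⊤ T))       ≡⟨ cong (λ t → t + (t + volume (innerGraph ⊤ T))) (deg-inner-star G) ⟩
    𝟘 + (𝟘 + volume (innerGraph ⊤ T))         <⟨ +-mono-≺-≼ 𝟘≺d (+-mono-≼ (inj₁ 𝟘≺d) inner≼cut) ⟩
    d + (d + volume (cutGraph ⊤ T))           ≡⟨ cong (λ t → t + (t + volume (cutGraph ⊤ T))) (deg-cut-star G) ⟨
    d꜀ + (d꜀ + volume (cutGraph ⊤ T))         ≡⟨ volume-tailGraph (cutGraph star G) ⟨
    volume (cutGraph star G)                  ∎
    where
    T = tailGraph G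
    d = deg F G fz
    dᵢ = deg F (innerGraph star G) fz
    d꜀ = deg F (cutGraph star G) fz
    inner≼cut : volume (innerGraph ⊤ T) ≼ volume (cutGraph ⊤ T)
    inner≼cut = begin
      volume (innerGraph ⊤ T)  ≤⟨ volume-innerGraph-≼ ⊤ T ⟩
      volume T                 ≡⟨ tail≡𝟘 ⟩
      𝟘                        ≤⟨ volume-nonneg (cutGraph ⊤ T) ⟩
      volume (cutGraph ⊤ T)    ∎

  dominatingCut⊎volume≡𝟘 : ∀ {n} (G : Graph F n) → ∃ (DominatingCut G) ⊎ volume G ≡ 𝟘
  dominatingCut⊎volume≡𝟘 {zero} G = inj₂ refl
  dominatingCut⊎volume≡𝟘 {suc n} G with dominatingCut⊎volume≡𝟘 (tailGraph G)
  ... | inj₁ (p , dominating) = inj₁ (extend-dominatingCut G {p} dominating)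
  ... | inj₂ tail≡𝟘 with deg-nonneg G fz
  ...   | inj₁ 𝟘≺d = inj₁ (star , star-dominatingCut G tail≡𝟘 𝟘≺d)
  ...   | inj₂ 𝟘≡d = inj₂ (begin-equality
    volume G                                   ≡⟨ volume-tailGraph G ⟩
    deg F G fz + (deg F G fz + volume (tailGraph G))  ≡⟨ cong₂ (λ t u → t + (t + u)) (sym 𝟘≡d) tail≡𝟘 ⟩
    𝟘 + (𝟘 + 𝟘)                                ≡⟨ trans (+-idˡ (𝟘 + 𝟘)) (+-idˡ 𝟘) ⟩
    𝟘                                          ∎)

  lookup-∁ : ∀ {n} (p : Subset n) x → lookup (∁ p) x ≡ not (lookup p x)
  lookup-∁ p x = lookup-map x not p

  volume-cutGraph-∁ : ∀ {n} (p : Subset n) (G : Graph F n) →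
                      volume (cutGraph (∁ p) G) ≡ volume (cutGraph p G)
  volume-cutGraph-∁ p G = ΣFin²-cong (λ x y → cong (λ k → keep k (b G x y))
    (trans (cong₂ _xor_ (lookup-∁ p x) (lookup-∁ p y)) (xor-annihilates-not (lookup p x) (lookup p y))))

  volume-cutGraph-⊥ : ∀ {n} (G : Graph F n) → volume (cutGraph ⊥ G) ≡ 𝟘
  volume-cutGraph-⊥ G = ΣFin-zero (λ x → ΣFin-zero (λ y → cong (λ k → keep k (b G x y))
    (cong₂ _xor_ (lookup-replicate x outside) (lookup-replicate y outside))))

  𝟘≺volume-cut⇒Nonempty : ∀ {n} {p : Subset n} (G : Graph F n) → 𝟘 ≺ volume (cutGraph p G) → Nonempty p
  𝟘≺volume-cut⇒Nonempty {p = p} G 𝟘≺cut with nonempty? p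
  ... | yes nonempty = nonempty
  ... | no empty = contradiction
    (trans (cong (λ q → volume (cutGraph q G)) (Empty-unique empty)) (volume-cutGraph-⊥ G))
    (𝟘≺x⇒x≢𝟘 𝟘≺cut)

  admissible-∁ : ∀ {n} {p : Subset n} (G : Graph F n) → 𝟘 ≺ volume (cutGraph p G) →
                 Admissible F G p (∁ p)
  admissible-∁ {p = p} G 𝟘≺cut =
      𝟘≺volume-cut⇒Nonempty G 𝟘≺cut
    , 𝟘≺volume-cut⇒Nonempty G (subst (𝟘 ≺_) (sym (volume-cutGraph-∁ p G)) 𝟘≺cut)
    , λ { (x , x∈p∩∁p) → ∉⊥ (subst (x ∈_) (∩-inverseʳ p) x∈p∩∁p) }

  bSet-+-bSet-∁ : ∀ {n} (p : Subset n) (G : Graph F n) → bSet F G p + bSet F G (∁ p) ≡ volume G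
  bSet-+-bSet-∁ p G =
    trans (sym (ΣFin-distrib-+ (λ x → keep (lookup p x) (deg F G x)) (λ x → keep (lookup (∁ p) x) (deg F G x))))
    (ΣFin-cong (λ x → keep-+-keep-not (lookup p x) (lookup (∁ p) x) (deg F G x) (lookup-∁ p x)))

  bPairTerm : ∀ {n} → Graph F n → Subset n → Subset n → Fin n → Fin n → K
  bPairTerm G V W x y = keep (lookup V x) (keep (lookup W y) (b G x y))

  bPair-comm : ∀ {n} (G : Graph F n) V W → bPair F G V W ≡ bPair F G W V
  bPair-comm G V W = trans (ΣFin-comm (bPairTerm G V W)) (ΣFin²-cong (λ x y →
    swap (lookup V y) (lookup W x) (b-sym G y x)))
    where
    swap : ∀ c d {u v} → u ≡ v → keep c (keep d u) ≡ keep d (keep c v)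
    swap true  true  u≡v = u≡v
    swap true  false _   = refl
    swap false true  _   = refl
    swap false false _   = refl

  volume-cutGraph≡bPair+bPair : ∀ {n} (p : Subset n) (G : Graph F n) →
                    volume (cutGraph p G) ≡ bPair F G p (∁ p) + bPair F G (∁ p) p
  volume-cutGraph≡bPair+bPair p G = trans
    (ΣFin²-cong (λ x y → split (lookup p x) (lookup p y) (lookup-∁ p x) (lookup-∁ p y)))
    (ΣFin²-distrib-+ (bPairTerm G p (∁ p)) (bPairTerm G (∁ p) p))
    where
    split : ∀ u v {u′ v′ w} → u′ ≡ not u → v′ ≡ not v →
            keep (u xor v) w ≡ keep u (keep v′ w) + keep u′ (keep v w)
    split true  true  refl refl = sym (+-idˡ 𝟘)
    split true  false refl refl = sym (+-identityʳ _)
    split false true  refl refl = sym (+-idˡ _)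
    split false false refl refl = sym (+-idˡ 𝟘)

  ratio-∁ : ∀ {n} (p : Subset n) (G : Graph F n) → ratio F G p (∁ p) ≡ volume (cutGraph p G) / volume G
  ratio-∁ p G = cong₂ _/_ (begin-equality
    𝟚 * bPair F G p (∁ p)                    ≡⟨ 𝟚*x≡x+x _ ⟩
    bPair F G p (∁ p) + bPair F G p (∁ p)    ≡⟨ cong (bPair F G p (∁ p) +_) (bPair-comm G p (∁ p)) ⟩
    bPair F G p (∁ p) + bPair F G (∁ p) p    ≡⟨ volume-cutGraph≡bPair+bPair p G ⟨
    volume (cutGraph p G)                    ∎) (bSet-+-bSet-∁ p G)

  half≺ratio : ∀ {n} {p : Subset n} (G : Graph F n) → HasEdge F G → DominatingCut G p →
               𝟙 / 𝟚 ≺ ratio F G p (∁ p)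
  half≺ratio {p = p} G hasEdge dominating = subst (𝟙 / 𝟚 ≺_) (sym (ratio-∁ p G))
    (half≺quotient (volume-pos G hasEdge) (begin-strict
      volume G                                        ≡⟨ volume-cut+inner p G ⟨
      volume (cutGraph p G) + volume (innerGraph p G) <⟨ +-monoʳ-≺ _ dominating ⟩
      volume (cutGraph p G) + volume (cutGraph p G)   ∎))

  half≺dualCheeger : ∀ {n} (G : Graph F n) → HasEdge F G → ∀ h → IsDualCheeger F G h → 𝟙 / 𝟚 ≺ h
  half≺dualCheeger G hasEdge h (_ , ratio≼h) with dominatingCut⊎volume≡𝟘 G
  ... | inj₂ volume≡𝟘 = contradiction volume≡𝟘 (𝟘≺x⇒x≢𝟘 (volume-pos G hasEdge))
  ... | inj₁ (p , dominating) = begin-strict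
    𝟙 / 𝟚              <⟨ half≺ratio {p = p} G hasEdge dominating ⟩
    ratio F G p (∁ p)  ≤⟨ ratio≼h p (∁ p) (admissible-∁ G 𝟘≺cut) ⟩
    h                  ∎
    where
    𝟘≺cut : 𝟘 ≺ volume (cutGraph p G)
    𝟘≺cut = begin-strict
      𝟘                        ≤⟨ volume-nonneg (innerGraph p G) ⟩
      volume (innerGraph p G)  <⟨ dominating ⟩
      volume (cutGraph p G)    ∎

mainTheorem3 : ∀ {ℓ : Level} (F : OrderedField ℓ) → IsRealClosed F →
    ∀ (n : ℕ) (G : Graph F n) →
    (∀ x → ¬ Isolated F G x) → HasEdge F G →
    ∀ h → IsDualCheeger F G h →
    OrderedField._≺_ F (OrderedField._/_ F (OrderedField.𝟙 F) (OrderedField.𝟚 F)) h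
mainTheorem3 F _ n G _ = WeightedGraphProperties.half≺dualCheeger F G
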